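{- Let $\mathcal{D}$ be the set of all Dyck paths, and for $D\in\mathcal{D}$ let $|D|$ be its semilength and $\mathrm{sval}(D)$ its number of symmetric valleys. Then, as formal power series, $$\sum_{D\in\mathcal{D}}s^{\mathrm{sval}(D)}z^{|D|}=\cfrac{1}{1+z-\cfrac{z}{1-(s-1)z[1]_z}-\cfrac{z}{1+z-\cfrac{z}{1-(s-1)z[2]_z}-\cfrac{z}{1+z-\cfrac{z}{1-(s-1)z[3]_z}-\cfrac{z}{\ddots}}}},$$ where $[k]_z=1+z+\dots+z^{k-1}$ (so $z[k]_z=z+z^2+\dots+z^k$), i.e. the $k$-th level of the continued fraction has the form $1+z-\frac{z}{1-(s-1)(z+z^2+\cdots+z^k)}-z\cdot(\text{next level})^{\,}$ in the denominator.
   Context: A Dyck path of semilength $n$ is a lattice path with steps $\mathbf{u}=(1,1)$ and $\mathbf{d}=(1,-1)$ from $(0,0)$ to $(2n,0)$ never going below the $x$-axis. A valley is an occurrence of consecutive steps $\mathbf{du}$. Every valley is contained in a unique maximal consecutive subsequence of the form $\mathbf{d}^i\mathbf{u}^j$ ($i,j\ge1$); the valley is symmetric if $i=j$. Precisely, the generating function equals $F_1$ where $F_k=1/\big(1+z-\frac{z}{1-(s-1)z[k]_z}-zF_{k+1}\big)$ for $k\ge1$, interpreted as the limit of the finite truncations as formal power series. -}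

module Defs where

open import Data.Nat using (ℕ; zero; suc; _∸_; _≡ᵇ_; _≤ᵇ_) renaming (_+_ to _+ℕ_; _*_ to _*ℕ_)
open import Data.Integer using (ℤ; +_; 0ℤ; 1ℤ; _+_; _*_; -_; _-_)
open import Data.Bool using (Bool; true; false; _∧_; if_then_else_)
open import Data.List using (List; []; _∷_; _++_; map)
open import Data.Product using (_×_; _,_)

data Step : Set where
  U D : Step

words : ℕ → List (List Step)
words zero = [] ∷ []
words (suc n) = map (U ∷_) (words n) ++ map (D ∷_) (words n)

dyckFrom : ℕ → List Step → Bool
dyckFrom h [] = h ≡ᵇ 0
dyckFrom h (U ∷ w) = dyckFrom (suc h) w
dyckFrom zero (D ∷ w) = false
dyckFrom (suc h) (D ∷ w) = dyckFrom h w

isDyck : List Step → Bool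
isDyck = dyckFrom 0

sameStep : Step → Step → Bool
sameStep U U = true
sameStep D D = true
sameStep _ _ = false

push : Step → List (Step × ℕ) → List (Step × ℕ)
push x [] = (x , 1) ∷ []
push x ((y , k) ∷ r) = if sameStep x y then (y , suc k) ∷ r else (x , 1) ∷ (y , k) ∷ r

runs : List Step → List (Step × ℕ)
runs [] = []
runs (x ∷ w) = push x (runs w)

-- number of maximal blocks d^i u^j with i = j (each valley lies in one such block)
svalRuns : List (Step × ℕ) → ℕ
svalRuns [] = 0
svalRuns ((D , i) ∷ (U , j) ∷ r) = (if i ≡ᵇ j then 1 else 0) +ℕ svalRuns ((U , j) ∷ r)
svalRuns (_ ∷ r) = svalRuns r

sval : List Step → ℕ
sval w = svalRuns (runs w)

countTrue : {A : Set} → (A → Bool) → List A → ℕ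
countTrue p [] = 0
countTrue p (x ∷ xs) = (if p x then 1 else 0) +ℕ countTrue p xs

dyckCount : ℕ → ℕ → ℕ
dyckCount n m = countTrue (λ w → isDyck w ∧ (sval w ≡ᵇ m)) (words (2 *ℕ n))

-- Formal power series in two variables: coefficient of z^n s^m

Ser : Set
Ser = ℕ → ℕ → ℤ

sumTo : ℕ → (ℕ → ℤ) → ℤ
sumTo zero f = f 0
sumTo (suc n) f = sumTo n f + f (suc n)

zeroS : Ser
zeroS _ _ = 0ℤ

oneS : Ser
oneS zero zero = 1ℤ
oneS _ _ = 0ℤ

zS : Ser
zS 1 zero = 1ℤ
zS _ _ = 0ℤ

sS : Ser
sS zero 1 = 1ℤ
sS _ _ = 0ℤ

_⊕_ : Ser → Ser → Ser
(f ⊕ g) n m = f n m + g n m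

_⊖_ : Ser → Ser → Ser
(f ⊖ g) n m = f n m - g n m

_⊗_ : Ser → Ser → Ser
(f ⊗ g) n m = sumTo n (λ i → sumTo m (λ j → f i j * g (n ∸ i) (m ∸ j)))

infixl 6 _⊕_ _⊖_
infixl 7 _⊗_

powS : Ser → ℕ → Ser
powS f zero = oneS
powS f (suc k) = powS f k ⊗ f

-- multiplicative inverse of a series D whose z^0-coefficient is 1:
-- 1/D = Σ_j (1 - D)^j, and (1 - D)^j has z-order ≥ j
invS : Ser → Ser
invS d n m = sumTo n (λ j → powS (oneS ⊖ d) j n m)

qint : ℕ → Ser
qint zero = zeroS
qint (suc k) = qint k ⊕ powS zS k

levelDen : ℕ → Ser → Ser
levelDen k F = oneS ⊕ zS ⊖ zS ⊗ invS (oneS ⊖ (sS ⊖ oneS) ⊗ zS ⊗ qint k) ⊖ zS ⊗ F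

cfTrunc : ℕ → ℕ → Ser
cfTrunc zero k = zeroS
cfTrunc (suc N) k = invS (levelDen k (cfTrunc N (suc k)))

-- Read a path from right to left. A suffix is described by the height h at which it must be
-- entered and by its run-length encoding, and a prefix completing it with d down steps has
-- length h + 2d; prepending u or d gives a recursion for the number of completions. To each
-- state we attach a series built from the limits F_k of the truncated continued fractions and
-- from B_k = 1/(1 − (s − 1) z [k]_z). The functional equations F_k (1 + z − z B_k − z F_{k+1}) = 1
-- and B_k (1 − (s − 1) z [k]_z) = 1 show that these series satisfy the same recursion, so F_1,
-- the series of the empty suffix, counts Dyck paths by semilength and symmetric valleys. The
-- z^n-coefficient of the truncation with N levels no longer changes once N > n.

module Submission where

open import Defs
open import Data.Nat using (ℕ; _≤_)
open import Data.Integer using (+_)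
open import Data.Product using (∃-syntax)
open import Relation.Binary.PropositionalEquality using (_≡_)

open import Algebra.Bundles using (CommutativeRing)
import Algebra.Properties.CommutativeSemigroup as CommutativeSemigroupProperties
open import Algebra.Solver.Ring.AlmostCommutativeRing using (fromCommutativeRing; _-Raw-AlmostCommutative⟶_)
open import Data.Bool using (Bool; true; false; _∧_; if_then_else_)
open import Data.Empty using (⊥-elim)
open import Data.Integer as ℤ using (ℤ; 0ℤ; 1ℤ)
import Data.Integer.Properties as ℤP
open import Data.List using (List; []; _∷_; _++_; _∷ʳ_; map; foldr)
open import Data.List.Properties using (foldr-∷ʳ)
open import Data.Maybe using (Maybe; just; nothing)
open import Data.Nat as ℕ using (zero; suc; _∸_; _<_; z≤n; s≤s)
import Data.Nat.Properties as ℕP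
open import Data.Product using (_×_; _,_)
open import Data.Sum using (inj₁; inj₂)
open import Function using (_∘_)
open import Relation.Binary.Structures using (IsEquivalence)
open import Relation.Nullary using (yes; no)

module FiniteSums {c ℓ} (R : CommutativeRing c ℓ) where

  open CommutativeRing R
  open import Algebra.Properties.CommutativeSemigroup +-commutativeSemigroup using (interchange)
  open import Relation.Binary.Reasoning.Setoid setoid
  open import Relation.Binary.PropositionalEquality as ≡ using (_≢_)

  sum≤ : ℕ → (ℕ → Carrier) → Carrier
  sum≤ zero    f = f 0
  sum≤ (suc n) f = sum≤ n f + f (suc n)

  sum≤-cong : ∀ n {f g} → (∀ i → i ≤ n → f i ≈ g i) → sum≤ n f ≈ sum≤ n g
  sum≤-cong zero    f≈g = f≈g 0 z≤n
  sum≤-cong (suc n) f≈g =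
    +-cong (sum≤-cong n (λ i i≤n → f≈g i (ℕP.m≤n⇒m≤1+n i≤n))) (f≈g (suc n) ℕP.≤-refl)

  sum≤-zero : ∀ n f → (∀ i → i ≤ n → f i ≈ 0#) → sum≤ n f ≈ 0#
  sum≤-zero n f f≈0 = trans (sum≤-cong n f≈0) (sum≤-const0 n)
    where
    sum≤-const0 : ∀ n → sum≤ n (λ _ → 0#) ≈ 0#
    sum≤-const0 zero    = refl
    sum≤-const0 (suc n) = trans (+-identityʳ _) (sum≤-const0 n)

  sum≤-+ : ∀ n f g → sum≤ n (λ i → f i + g i) ≈ sum≤ n f + sum≤ n g
  sum≤-+ zero    f g = refl
  sum≤-+ (suc n) f g = trans (+-cong (sum≤-+ n f g) refl) (interchange _ _ _ _)

  *-distribˡ-sum≤ : ∀ n x f → x * sum≤ n f ≈ sum≤ n (λ i → x * f i)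
  *-distribˡ-sum≤ zero    x f = refl
  *-distribˡ-sum≤ (suc n) x f = trans (distribˡ x _ _) (+-cong (*-distribˡ-sum≤ n x f) refl)

  *-distribʳ-sum≤ : ∀ n x f → sum≤ n f * x ≈ sum≤ n (λ i → f i * x)
  *-distribʳ-sum≤ zero    x f = refl
  *-distribʳ-sum≤ (suc n) x f = trans (distribʳ x _ _) (+-cong (*-distribʳ-sum≤ n x f) refl)

  sum≤-single : ∀ n k f → k ≤ n → (∀ i → i ≤ n → i ≢ k → f i ≈ 0#) → sum≤ n f ≈ f k
  sum≤-single zero    zero f _   _      = refl
  sum≤-single (suc n) k    f k≤n others with k ℕ.≟ suc n
  ... | yes ≡.refl = trans (+-cong (sum≤-zero n f below) refl) (+-identityˡ _)
    where
    below : ∀ i → i ≤ n → f i ≈ 0#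
    below i i≤n = others i (ℕP.m≤n⇒m≤1+n i≤n) (ℕP.<⇒≢ (s≤s i≤n))
  ... | no k≢1+n = trans (+-cong (sum≤-single n k f k≤n′ below) (others (suc n) ℕP.≤-refl (k≢1+n ∘ ≡.sym)))
                         (+-identityʳ _)
    where
    k≤n′ = ℕP.≤-pred (ℕP.≤∧≢⇒< k≤n k≢1+n)
    below : ∀ i → i ≤ n → i ≢ k → f i ≈ 0#
    below i i≤n = others i (ℕP.m≤n⇒m≤1+n i≤n)

  sum≤-extend : ∀ {n} N f → n ≤ N → (∀ j → n < j → f j ≈ 0#) → sum≤ n f ≈ sum≤ N f
  sum≤-extend N f n≤N vanish with ℕP.m≤n⇒m<n∨m≡n n≤N
  ... | inj₂ ≡.refl = refl
  sum≤-extend (suc N) f _ vanish | inj₁ n<1+N = begin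
    _                       ≈⟨ sum≤-extend N f (ℕP.≤-pred n<1+N) vanish ⟩
    sum≤ N f                ≈⟨ +-identityʳ _ ⟨
    sum≤ N f + 0#           ≈⟨ +-cong refl (vanish (suc N) n<1+N) ⟨
    sum≤ N f + f (suc N)    ∎

  sum≤-suc : ∀ n g → sum≤ (suc n) g ≈ g 0 + sum≤ n (g ∘ suc)
  sum≤-suc zero    g = refl
  sum≤-suc (suc n) g = trans (+-cong (sum≤-suc n g) refl) (+-assoc _ _ _)

  sum≤-reverse : ∀ n f → sum≤ n f ≈ sum≤ n (λ i → f (n ∸ i))
  sum≤-reverse zero    f = refl
  sum≤-reverse (suc n) f = begin
    sum≤ n f + f (suc n)                    ≈⟨ +-cong (sum≤-reverse n f) refl ⟩
    sum≤ n (λ i → f (n ∸ i)) + f (suc n)    ≈⟨ +-comm _ _ ⟩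
    f (suc n) + sum≤ n (λ i → f (n ∸ i))    ≈⟨ sum≤-suc n (λ i → f (suc n ∸ i)) ⟨
    sum≤ (suc n) (λ i → f (suc n ∸ i))      ∎

  sum≤-bound : ∀ {m n} f → m ≡ n → sum≤ m f ≈ sum≤ n f
  sum≤-bound f ≡.refl = refl

  sum≤-triangle : ∀ n (F : ℕ → ℕ → Carrier) →
    sum≤ n (λ i → sum≤ i (λ a → F a i)) ≈ sum≤ n (λ a → sum≤ (n ∸ a) (λ b → F a (a ℕ.+ b)))
  sum≤-triangle zero    F = refl
  sum≤-triangle (suc n) F = begin
      sum≤ n (λ i → sum≤ i (λ a → F a i)) + sum≤ (suc n) (λ a → F a (suc n))
    ≈⟨ +-cong (sum≤-triangle n F) refl ⟩
      rows n + (sum≤ n (λ a → F a (suc n)) + F (suc n) (suc n))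
    ≈⟨ +-assoc _ _ _ ⟨
      (rows n + sum≤ n (λ a → F a (suc n))) + F (suc n) (suc n)
    ≈⟨ +-cong (sum≤-+ n _ _) (reflexive (≡.cong (F (suc n)) (ℕP.+-identityʳ (suc n)))) ⟨
      sum≤ n (λ a → sum≤ (n ∸ a) (λ b → F a (a ℕ.+ b)) + F a (suc n)) + F (suc n) (suc n ℕ.+ 0)
    ≈⟨ +-cong (sum≤-cong n extendRow) (sum≤-bound (λ b → F (suc n) (suc n ℕ.+ b)) (≡.sym (ℕP.n∸n≡0 n))) ⟩
      sum≤ (suc n) (λ a → sum≤ (suc n ∸ a) (λ b → F a (a ℕ.+ b))) ∎
    where
    rows : ℕ → Carrier
    rows n = sum≤ n (λ a → sum≤ (n ∸ a) (λ b → F a (a ℕ.+ b)))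
    extendRow : ∀ a → a ≤ n →
      sum≤ (n ∸ a) (λ b → F a (a ℕ.+ b)) + F a (suc n) ≈ sum≤ (suc n ∸ a) (λ b → F a (a ℕ.+ b))
    extendRow a a≤n = begin
        sum≤ (n ∸ a) (λ b → F a (a ℕ.+ b)) + F a (suc n)
      ≈⟨ +-cong refl (reflexive (≡.cong (F a) a+[1+n-a]≡1+n)) ⟨
        sum≤ (suc (n ∸ a)) (λ b → F a (a ℕ.+ b))
      ≈⟨ sum≤-bound _ (≡.sym (ℕP.+-∸-assoc 1 a≤n)) ⟩
        sum≤ (suc n ∸ a) (λ b → F a (a ℕ.+ b)) ∎
      where
      a+[1+n-a]≡1+n : a ℕ.+ suc (n ∸ a) ≡ suc n
      a+[1+n-a]≡1+n = ≡.trans (ℕP.+-suc a (n ∸ a)) (≡.cong suc (ℕP.m+[n∸m]≡n a≤n))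

module PowerSeries {c ℓ} (R : CommutativeRing c ℓ) where

  open CommutativeRing R
  open FiniteSums R using (sum≤; sum≤-cong; sum≤-+; sum≤-zero; sum≤-single; sum≤-reverse;
                           sum≤-triangle; *-distribˡ-sum≤; *-distribʳ-sum≤)
  open import Relation.Binary.Reasoning.Setoid setoid
  open import Relation.Binary.PropositionalEquality as ≡ using (_≢_)
  open import Algebra.Structures using (IsCommutativeRing)

  Series : Set c
  Series = ℕ → Carrier

  infix 4 _≈ₛ_
  record _≈ₛ_ (f g : Series) : Set ℓ where
    constructor mk≈ₛ
    field coeff : ∀ n → f n ≈ g n
  open _≈ₛ_ public

  infixl 6 _+ₛ_
  infixl 7 _*ₛ_

  _+ₛ_ : Series → Series → Series
  (f +ₛ g) n = f n + g n

  -ₛ_ : Series → Series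
  (-ₛ f) n = - f n

  _*ₛ_ : Series → Series → Series
  (f *ₛ g) n = sum≤ n (λ i → f i * g (n ∸ i))

  const : Carrier → Series
  const x zero    = x
  const x (suc _) = 0#

  -- Constant series, so that numerals of the ring solver over ℤ are definitionally the 0# and 1#
  -- of iterated series rings.
  0ₛ : Series
  0ₛ = const 0#

  0ₛ-coeff : ∀ n → 0ₛ n ≈ 0#
  0ₛ-coeff zero    = refl
  0ₛ-coeff (suc _) = refl

  1ₛ : Series
  1ₛ = const 1#

  ≈ₛ-isEquivalence : IsEquivalence _≈ₛ_
  ≈ₛ-isEquivalence = record
    { refl  = mk≈ₛ λ _ → refl
    ; sym   = λ f≈g → mk≈ₛ λ n → sym (coeff f≈g n)
    ; trans = λ f≈g g≈h → mk≈ₛ λ n → trans (coeff f≈g n) (coeff g≈h n)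
    }

  *ₛ-cong : ∀ {f f′ g g′} → f ≈ₛ f′ → g ≈ₛ g′ → f *ₛ g ≈ₛ f′ *ₛ g′
  *ₛ-cong f≈f′ g≈g′ = mk≈ₛ λ n → sum≤-cong n λ i _ → *-cong (coeff f≈f′ i) (coeff g≈g′ (n ∸ i))

  *ₛ-comm : ∀ f g → f *ₛ g ≈ₛ g *ₛ f
  *ₛ-comm f g = mk≈ₛ λ n → begin
    sum≤ n (λ i → f i * g (n ∸ i))                ≈⟨ sum≤-reverse n _ ⟩
    sum≤ n (λ i → f (n ∸ i) * g (n ∸ (n ∸ i)))    ≈⟨ sum≤-cong n (λ i i≤n →
        trans (*-comm _ _) (*-cong (reflexive (≡.cong g (ℕP.m∸[m∸n]≡n i≤n))) refl)) ⟩
    sum≤ n (λ i → g i * f (n ∸ i))                ∎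

  *ₛ-identityˡ : ∀ f → 1ₛ *ₛ f ≈ₛ f
  *ₛ-identityˡ f = mk≈ₛ λ n → trans (sum≤-single n 0 _ z≤n others) (*-identityˡ _)
    where
    others : ∀ {n} i → i ≤ n → i ≢ 0 → 1ₛ i * f (n ∸ i) ≈ 0#
    others zero    _ 0≢0 = ⊥-elim (0≢0 ≡.refl)
    others (suc i) _ _   = zeroˡ _

  *ₛ-distribˡ : ∀ f g h → f *ₛ (g +ₛ h) ≈ₛ f *ₛ g +ₛ f *ₛ h
  *ₛ-distribˡ f g h = mk≈ₛ λ n → trans (sum≤-cong n λ i _ → distribˡ _ _ _) (sum≤-+ n _ _)

  *ₛ-assoc : ∀ f g h → (f *ₛ g) *ₛ h ≈ₛ f *ₛ (g *ₛ h)
  *ₛ-assoc f g h = mk≈ₛ λ n → begin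
      sum≤ n (λ i → sum≤ i (λ a → f a * g (i ∸ a)) * h (n ∸ i))
    ≈⟨ sum≤-cong n (λ i _ → *-distribʳ-sum≤ i _ _) ⟩
      sum≤ n (λ i → sum≤ i (λ a → f a * g (i ∸ a) * h (n ∸ i)))
    ≈⟨ sum≤-triangle n (λ a i → f a * g (i ∸ a) * h (n ∸ i)) ⟩
      sum≤ n (λ a → sum≤ (n ∸ a) (λ b → f a * g (a ℕ.+ b ∸ a) * h (n ∸ (a ℕ.+ b))))
    ≈⟨ sum≤-cong n (λ a _ → trans (sum≤-cong (n ∸ a) (λ b _ → reassociate n a b))
                                   (sym (*-distribˡ-sum≤ (n ∸ a) _ _))) ⟩
      sum≤ n (λ a → f a * sum≤ (n ∸ a) (λ b → g b * h (n ∸ a ∸ b))) ∎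
    where
    reassociate : ∀ n a b → f a * g (a ℕ.+ b ∸ a) * h (n ∸ (a ℕ.+ b)) ≈ f a * (g b * h (n ∸ a ∸ b))
    reassociate n a b = trans (*-assoc _ _ _) (*-cong refl (*-cong
      (reflexive (≡.cong g (ℕP.m+n∸m≡n a b))) (reflexive (≡.cong h (≡.sym (ℕP.∸-+-assoc n a b))))))

  series-isCommutativeRing : IsCommutativeRing _≈ₛ_ _+ₛ_ _*ₛ_ -ₛ_ 0ₛ 1ₛ
  series-isCommutativeRing = record
    { isRing = record
      { +-isAbelianGroup = record
        { isGroup = record
          { isMonoid = record
            { isSemigroup = record
              { isMagma = record
                { isEquivalence = ≈ₛ-isEquivalence
                ; ∙-cong = λ f≈f′ g≈g′ → mk≈ₛ λ n → +-cong (coeff f≈f′ n) (coeff g≈g′ n) }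
              ; assoc = λ f g h → mk≈ₛ λ n → +-assoc (f n) (g n) (h n) }
            ; identity = (λ f → mk≈ₛ λ n → trans (+-cong (0ₛ-coeff n) refl) (+-identityˡ (f n)))
                       , (λ f → mk≈ₛ λ n → trans (+-cong refl (0ₛ-coeff n)) (+-identityʳ (f n))) }
          ; inverse = (λ f → mk≈ₛ λ n → trans (-‿inverseˡ (f n)) (sym (0ₛ-coeff n)))
                    , (λ f → mk≈ₛ λ n → trans (-‿inverseʳ (f n)) (sym (0ₛ-coeff n)))
          ; ⁻¹-cong = λ f≈g → mk≈ₛ λ n → -‿cong (coeff f≈g n) }
        ; comm = λ f g → mk≈ₛ λ n → +-comm (f n) (g n) }
      ; *-cong = *ₛ-cong
      ; *-assoc = *ₛ-assoc
      ; *-identity = *ₛ-identityˡ , λ f → S.trans (*ₛ-comm f 1ₛ) (*ₛ-identityˡ f)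
      ; distrib = *ₛ-distribˡ , λ f g h → S.trans (*ₛ-comm (g +ₛ h) f)
          (S.trans (*ₛ-distribˡ f g h) (mk≈ₛ λ n → +-cong (coeff (*ₛ-comm f g) n) (coeff (*ₛ-comm f h) n)))
      }
    ; *-comm = *ₛ-comm
    }
    where module S = IsEquivalence ≈ₛ-isEquivalence

  seriesRing : CommutativeRing c ℓ
  seriesRing = record { isCommutativeRing = series-isCommutativeRing }

  const-cong : ∀ {x y} → x ≈ y → const x ≈ₛ const y
  const-cong x≈y = mk≈ₛ λ { zero → x≈y ; (suc _) → refl }

  const-+ : ∀ x y → const (x + y) ≈ₛ const x +ₛ const y
  const-+ x y = mk≈ₛ λ { zero → refl ; (suc _) → sym (+-identityˡ 0#) }

  const-‿ : ∀ x → const (- x) ≈ₛ -ₛ const x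
  const-‿ x = mk≈ₛ λ { zero → refl ; (suc _) → sym (trans (sym (+-identityˡ (- 0#))) (-‿inverseʳ 0#)) }

  const-* : ∀ x y → const x *ₛ const y ≈ₛ const (x * y)
  const-* x y = mk≈ₛ λ
    { zero    → refl
    ; (suc n) → sum≤-zero (suc n) _ λ { zero _ → zeroʳ x ; (suc i) _ → zeroˡ _ } }

-- Opened only here, as inside the modules above refl, sym and trans are those of the ring.
open import Relation.Binary.PropositionalEquality using (_≢_; refl; sym; trans; cong; cong₂; module ≡-Reasoning)

-- The ring ℤ[[s]][[z]]

ℤ-ring : CommutativeRing _ _
ℤ-ring = ℤP.+-*-commutativeRing

module ℤ⟦s⟧ = PowerSeries ℤ-ring
module ℤ⟦s⟧⟦z⟧ = PowerSeries ℤ⟦s⟧.seriesRing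

𝕊 : CommutativeRing _ _
𝕊 = ℤ⟦s⟧⟦z⟧.seriesRing

module 𝕊 = CommutativeRing 𝕊
open 𝕊 using (_≈_; _+_; _*_; _-_; 0#; 1#; +-cong; *-cong)

module Σℤ = FiniteSums ℤ-ring
module Σs = FiniteSums ℤ⟦s⟧.seriesRing

ι : ℤ → Ser
ι k = ℤ⟦s⟧⟦z⟧.const (ℤ⟦s⟧.const k)

ι-homomorphism : CommutativeRing.rawRing ℤ-ring -Raw-AlmostCommutative⟶ fromCommutativeRing 𝕊
ι-homomorphism = record
  { ⟦_⟧    = ι
  ; +-homo = λ x y → 𝕊.trans (ℤ⟦s⟧⟦z⟧.const-cong (ℤ⟦s⟧.const-+ x y)) (ℤ⟦s⟧⟦z⟧.const-+ _ _)
  ; *-homo = λ x y → 𝕊.sym (𝕊.trans (ℤ⟦s⟧⟦z⟧.const-* _ _) (ℤ⟦s⟧⟦z⟧.const-cong (ℤ⟦s⟧.const-* x y)))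
  ; -‿homo = λ x → 𝕊.trans (ℤ⟦s⟧⟦z⟧.const-cong (ℤ⟦s⟧.const-‿ x)) (ℤ⟦s⟧⟦z⟧.const-‿ _)
  ; 0-homo = 𝕊.refl
  ; 1-homo = 𝕊.refl
  }

ι-equal? : ∀ a b → Maybe (ι a ≈ ι b)
ι-equal? a b with a ℤ.≟ b
... | yes refl = just 𝕊.refl
... | no _     = nothing

open import Algebra.Solver.Ring (CommutativeRing.rawRing ℤ-ring) (fromCommutativeRing 𝕊) ι-homomorphism ι-equal?
  using (solve; _:=_; _:+_; _:*_; _:-_; con)

≈⇒≡ : ∀ {X Y} → X ≈ Y → ∀ n m → X n m ≡ Y n m
≈⇒≡ X≈Y n m = ℤ⟦s⟧.coeff (ℤ⟦s⟧⟦z⟧.coeff X≈Y n) m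

≡⇒≈ : ∀ {X Y} → (∀ n m → X n m ≡ Y n m) → X ≈ Y
≡⇒≈ X≡Y = ℤ⟦s⟧⟦z⟧.mk≈ₛ λ n → ℤ⟦s⟧.mk≈ₛ λ m → X≡Y n m

sumTo≡sum≤ : ∀ n f → sumTo n f ≡ Σℤ.sum≤ n f
sumTo≡sum≤ zero    f = refl
sumTo≡sum≤ (suc n) f = cong (ℤ._+ f (suc n)) (sumTo≡sum≤ n f)

Σs-coeff : ∀ n F m → Σs.sum≤ n F m ≡ Σℤ.sum≤ n (λ i → F i m)
Σs-coeff zero    F m = refl
Σs-coeff (suc n) F m = cong (ℤ._+ F (suc n) m) (Σs-coeff n F m)

*-coeff : ∀ X Y n m →
  (X * Y) n m ≡ Σℤ.sum≤ n (λ i → Σℤ.sum≤ m (λ j → X i j ℤ.* Y (n ∸ i) (m ∸ j)))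
*-coeff X Y n m = Σs-coeff n _ m

⊗≈* : ∀ X Y → X ⊗ Y ≈ X * Y
⊗≈* X Y = ≡⇒≈ λ n m → trans (sumTo≡sum≤ n _)
  (trans (Σℤ.sum≤-cong n (λ i _ → sumTo≡sum≤ m _)) (sym (*-coeff X Y n m)))

oneS≈1# : oneS ≈ 1#
oneS≈1# = ≡⇒≈ λ { zero zero → refl ; zero (suc m) → refl ; (suc n) zero → refl ; (suc n) (suc m) → refl }

zeroS≈0# : zeroS ≈ 0#
zeroS≈0# = ≡⇒≈ λ { zero zero → refl ; zero (suc m) → refl ; (suc n) zero → refl ; (suc n) (suc m) → refl }

infixr 8 _^_
_^_ : Ser → ℕ → Ser
X ^ zero  = 1#
X ^ suc n = X * X ^ n

powS≈^ : ∀ X j → powS X j ≈ X ^ j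
powS≈^ X zero    = oneS≈1#
powS≈^ X (suc j) = 𝕊.trans (⊗≈* (powS X j) X) (𝕊.trans (*-cong (powS≈^ X j) (𝕊.refl {X})) (𝕊.*-comm (X ^ j) X))

Z S : Ser
Z = zS
S = sS

Z*-coeff-zero : ∀ X m → (Z * X) 0 m ≡ 0ℤ
Z*-coeff-zero X m = trans (*-coeff Z X 0 m) (Σℤ.sum≤-zero m _ λ _ _ → refl)

Z*-coeff-suc : ∀ X n m → (Z * X) (suc n) m ≡ X n m
Z*-coeff-suc X n m =
  trans (*-coeff Z X (suc n) m) (trans (Σℤ.sum≤-single (suc n) 1 _ (s≤s z≤n) others) row1)
  where
  others : ∀ i → i ≤ suc n → i ≢ 1 → Σℤ.sum≤ m (λ j → Z i j ℤ.* X (suc n ∸ i) (m ∸ j)) ≡ 0ℤ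
  others zero          _ _   = Σℤ.sum≤-zero m _ λ _ _ → refl
  others (suc zero)    _ 1≢1 = ⊥-elim (1≢1 refl)
  others (suc (suc i)) _ _   = Σℤ.sum≤-zero m _ λ _ _ → refl
  row1 : Σℤ.sum≤ m (λ j → Z 1 j ℤ.* X n (m ∸ j)) ≡ X n m
  row1 = trans (Σℤ.sum≤-single m 0 _ z≤n λ { zero _ 0≢0 → ⊥-elim (0≢0 refl) ; (suc j) _ _ → refl })
               (ℤP.*-identityˡ _)

S*-coeff-zero : ∀ X n → (S * X) n 0 ≡ 0ℤ
S*-coeff-zero X n = trans (*-coeff S X n 0) (Σℤ.sum≤-zero n _ λ { zero _ → refl ; (suc i) _ → refl })

S*-coeff-suc : ∀ X n m → (S * X) n (suc m) ≡ X n m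
S*-coeff-suc X n m =
  trans (*-coeff S X n (suc m)) (trans (Σℤ.sum≤-single n 0 _ z≤n others) column1)
  where
  others : ∀ i → i ≤ n → i ≢ 0 → Σℤ.sum≤ (suc m) (λ j → S i j ℤ.* X (n ∸ i) (suc m ∸ j)) ≡ 0ℤ
  others zero    _ 0≢0 = ⊥-elim (0≢0 refl)
  others (suc i) _ _   = Σℤ.sum≤-zero (suc m) _ λ _ _ → refl
  column1 : Σℤ.sum≤ (suc m) (λ j → S 0 j ℤ.* X n (suc m ∸ j)) ≡ X n m
  column1 = trans (Σℤ.sum≤-single (suc m) 1 _ (s≤s z≤n)
                     λ { zero _ _ → refl ; (suc zero) _ 1≢1 → ⊥-elim (1≢1 refl) ; (suc (suc j)) _ _ → refl })
                  (ℤP.*-identityˡ _)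

S^-coeff-zero : ∀ c m → (S ^ c) 0 m ≡ (if c ℕ.≡ᵇ m then 1ℤ else 0ℤ)
S^-coeff-zero zero    zero    = refl
S^-coeff-zero zero    (suc m) = refl
S^-coeff-zero (suc c) zero    = S*-coeff-zero (S ^ c) 0
S^-coeff-zero (suc c) (suc m) = trans (S*-coeff-suc (S ^ c) 0 m) (S^-coeff-zero c m)

S^-coeff-suc : ∀ c n m → (S ^ c) (suc n) m ≡ 0ℤ
S^-coeff-suc zero    n zero    = refl
S^-coeff-suc zero    n (suc m) = refl
S^-coeff-suc (suc c) n zero    = S*-coeff-zero (S ^ c) (suc n)
S^-coeff-suc (suc c) n (suc m) = trans (S*-coeff-suc (S ^ c) (suc n) m) (S^-coeff-suc c n m)

-- Agreement below a z-degree, and inverses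

infix 4 _≈[_]_
_≈[_]_ : Ser → ℕ → Ser → Set
X ≈[ B ] Y = ∀ n → n < B → ∀ m → X n m ≡ Y n m

≈[]-⊖ : ∀ {X X′ Y Y′ B} → X ≈[ B ] X′ → Y ≈[ B ] Y′ → X ⊖ Y ≈[ B ] X′ ⊖ Y′
≈[]-⊖ X≈X′ Y≈Y′ n n<B m = cong₂ ℤ._-_ (X≈X′ n n<B m) (Y≈Y′ n n<B m)

≈[]-* : ∀ {X X′ Y Y′ B} → X ≈[ B ] X′ → Y ≈[ B ] Y′ → X * Y ≈[ B ] X′ * Y′
≈[]-* {X} {X′} {Y} {Y′} X≈X′ Y≈Y′ n n<B m =
  trans (*-coeff X Y n m) (trans (Σℤ.sum≤-cong n lowTerms) (sym (*-coeff X′ Y′ n m)))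
  where
  lowTerms : ∀ i → i ≤ n →
    Σℤ.sum≤ m (λ j → X i j ℤ.* Y (n ∸ i) (m ∸ j)) ≡ Σℤ.sum≤ m (λ j → X′ i j ℤ.* Y′ (n ∸ i) (m ∸ j))
  lowTerms i i≤n = Σℤ.sum≤-cong m λ j _ → cong₂ ℤ._*_
    (X≈X′ i (ℕP.≤-<-trans i≤n n<B) j) (Y≈Y′ (n ∸ i) (ℕP.≤-<-trans (ℕP.m∸n≤m n i) n<B) (m ∸ j))

≈[]-⊗ : ∀ {X X′ Y Y′ B} → X ≈[ B ] X′ → Y ≈[ B ] Y′ → X ⊗ Y ≈[ B ] X′ ⊗ Y′
≈[]-⊗ {X} {X′} {Y} {Y′} X≈X′ Y≈Y′ n n<B m =
  trans (≈⇒≡ (⊗≈* X Y) n m) (trans (≈[]-* X≈X′ Y≈Y′ n n<B m) (sym (≈⇒≡ (⊗≈* X′ Y′) n m)))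

Z⊗-coeff-zero : ∀ X m → (zS ⊗ X) 0 m ≡ 0ℤ
Z⊗-coeff-zero X m = trans (≈⇒≡ (⊗≈* zS X) 0 m) (Z*-coeff-zero X m)

≈[]-Z⊗ : ∀ {X Y B} → X ≈[ B ] Y → zS ⊗ X ≈[ suc B ] zS ⊗ Y
≈[]-Z⊗ {X} {Y} X≈Y zero    _         m = trans (Z⊗-coeff-zero X m) (sym (Z⊗-coeff-zero Y m))
≈[]-Z⊗ {X} {Y} X≈Y (suc n) (s≤s n<B) m = begin
  (zS ⊗ X) (suc n) m   ≡⟨ ≈⇒≡ (⊗≈* zS X) (suc n) m ⟩
  (Z * X) (suc n) m    ≡⟨ Z*-coeff-suc X n m ⟩
  X n m                ≡⟨ X≈Y n n<B m ⟩
  Y n m                ≡⟨ Z*-coeff-suc Y n m ⟨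
  (Z * Y) (suc n) m    ≡⟨ ≈⇒≡ (⊗≈* zS Y) (suc n) m ⟨
  (zS ⊗ Y) (suc n) m   ∎
  where open ≡-Reasoning

≈[]-powS : ∀ {e e′ B} → e ≈[ B ] e′ → ∀ j → powS e j ≈[ B ] powS e′ j
≈[]-powS e≈e′ zero    _ _ _ = refl
≈[]-powS e≈e′ (suc j)       = ≈[]-⊗ (≈[]-powS e≈e′ j) e≈e′

sumTo-cong : ∀ n {f g} → (∀ j → f j ≡ g j) → sumTo n f ≡ sumTo n g
sumTo-cong zero    f≡g = f≡g 0
sumTo-cong (suc n) f≡g = cong₂ ℤ._+_ (sumTo-cong n f≡g) (f≡g (suc n))

≈[]-invS : ∀ {d d′ B} → d ≈[ B ] d′ → invS d ≈[ B ] invS d′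
≈[]-invS d≈d′ n n<B m = sumTo-cong n λ j → ≈[]-powS (≈[]-⊖ {oneS} {oneS} (λ _ _ _ → refl) d≈d′) j n n<B m

*-order : ∀ {X Y} a b → X ≈[ a ] zeroS → Y ≈[ b ] zeroS → X * Y ≈[ a ℕ.+ b ] zeroS
*-order {X} {Y} a b X≈0 Y≈0 n n<a+b m =
  trans (*-coeff X Y n m) (Σℤ.sum≤-zero n _ λ i i≤n → Σℤ.sum≤-zero m _ λ j _ → term i i≤n j)
  where
  term : ∀ i → i ≤ n → ∀ j → X i j ℤ.* Y (n ∸ i) (m ∸ j) ≡ 0ℤ
  term i i≤n j with i ℕP.<? a
  ... | yes i<a = trans (cong (ℤ._* Y (n ∸ i) (m ∸ j)) (X≈0 i i<a j)) (ℤP.*-zeroˡ (Y (n ∸ i) (m ∸ j)))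
  ... | no  i≮a = trans (cong (X i j ℤ.*_) (Y≈0 (n ∸ i) n-i<b (m ∸ j))) (ℤP.*-zeroʳ (X i j))
    where
    n-i<b : n ∸ i < b
    n-i<b = ℕP.≤-trans (ℕP.≤-reflexive (sym (ℕP.+-∸-assoc 1 i≤n)))
              (ℕP.≤-trans (ℕP.∸-monoʳ-≤ (suc n) (ℕP.≮⇒≥ i≮a)) (ℕP.m≤n+o⇒m∸n≤o (suc n) a n<a+b))

^-order : ∀ {e} → e ≈[ 1 ] zeroS → ∀ j → e ^ j ≈[ j ] zeroS
^-order e≈0 zero    _ ()
^-order e≈0 (suc j) = *-order 1 j e≈0 (^-order e≈0 j)

geometric : Ser → ℕ → Ser
geometric e zero    = 1#
geometric e (suc n) = geometric e n + e ^ suc n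

geometric-sum : ∀ e n → geometric e n * (1# - e) ≈ 1# - e ^ suc n
geometric-sum e zero    = solve 1 (λ e → con 1ℤ :* (con 1ℤ :- e) := con 1ℤ :- e :* con 1ℤ) 𝕊.refl e
geometric-sum e (suc n) = begin
  (geometric e n + p) * (1# - e)              ≈⟨ 𝕊.distribʳ (1# - e) (geometric e n) p ⟩
  geometric e n * (1# - e) + p * (1# - e)     ≈⟨ +-cong (geometric-sum e n) 𝕊.refl ⟩
  (1# - p) + p * (1# - e)                     ≈⟨ solve 2 (λ p e → (con 1ℤ :- p) :+ p :* (con 1ℤ :- e)
                                                                   := con 1ℤ :- e :* p) 𝕊.refl p e ⟩
  1# - e * p                                  ∎
  where
  open import Relation.Binary.Reasoning.Setoid 𝕊.setoid
  p = e ^ suc n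

geometric-coeff : ∀ e n i m → geometric e n i m ≡ sumTo n (λ j → (e ^ j) i m)
geometric-coeff e zero    i m = refl
geometric-coeff e (suc n) i m = cong (ℤ._+ (e ^ suc n) i m) (geometric-coeff e n i m)

sumTo-extend : ∀ {n} N f → n ≤ N → (∀ j → n < j → f j ≡ 0ℤ) → sumTo n f ≡ sumTo N f
sumTo-extend {n} N f n≤N vanish =
  trans (sumTo≡sum≤ n f) (trans (Σℤ.sum≤-extend N f n≤N vanish) (sym (sumTo≡sum≤ N f)))

invS≈[]geometric : ∀ {d} → (oneS ⊖ d) ≈[ 1 ] zeroS → ∀ n → invS d ≈[ suc n ] geometric (oneS ⊖ d) n
invS≈[]geometric {d} e≈0 n i i<1+n m = begin
  sumTo i (λ j → powS e j i m)    ≡⟨ sumTo-cong i (λ j → ≈⇒≡ (powS≈^ e j) i m) ⟩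
  sumTo i (λ j → (e ^ j) i m)     ≡⟨ sumTo-extend n _ (ℕP.≤-pred i<1+n) (λ j i<j → ^-order e≈0 j i i<j m) ⟩
  sumTo n (λ j → (e ^ j) i m)     ≡⟨ geometric-coeff e n i m ⟨
  geometric e n i m               ∎
  where
  open ≡-Reasoning
  e = oneS ⊖ d

invS-inverse : ∀ d → d ≈[ 1 ] oneS → invS d * d ≈ 1#
invS-inverse d d≈1 = ≡⇒≈ λ n m → begin
  (invS d * d) n m                   ≡⟨ ≈[]-* {Y = d} {Y′ = d} (invS≈[]geometric e≈0 n) (λ _ _ _ → refl)
                                               n ℕP.≤-refl m ⟩
  (geometric e n * d) n m            ≡⟨ ≈⇒≡ (*-cong (𝕊.refl {geometric e n}) d≈1-e) n m ⟩
  (geometric e n * (1# - e)) n m     ≡⟨ ≈⇒≡ (geometric-sum e n) n m ⟩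
  1# n m ℤ.- (e ^ suc n) n m         ≡⟨ cong (λ t → 1# n m ℤ.- t) (^-order e≈0 (suc n) n ℕP.≤-refl m) ⟩
  1# n m ℤ.- 0ℤ                      ≡⟨ ℤP.+-identityʳ _ ⟩
  1# n m                             ∎
  where
  open ≡-Reasoning
  e = oneS ⊖ d
  e≈0 : e ≈[ 1 ] zeroS
  e≈0 (suc n) (s≤s ()) _
  e≈0 zero    _        m = trans (cong (λ t → oneS 0 m ℤ.- t) (d≈1 0 (s≤s z≤n) m)) (ℤP.+-inverseʳ (oneS 0 m))
  d≈1-e : d ≈ 1# - e
  d≈1-e = 𝕊.trans (solve 2 (λ d o → d := o :- (o :- d)) 𝕊.refl d oneS)
                   (+-cong oneS≈1# (𝕊.refl {𝕊.- e}))

-- The continued fraction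

B : ℕ → Ser
B k = invS (oneS ⊖ (sS ⊖ oneS) ⊗ zS ⊗ qint k)

levelDen≈[]1 : ∀ k X → levelDen k X ≈[ 1 ] oneS
levelDen≈[]1 k X (suc n) (s≤s ()) _
levelDen≈[]1 k X zero    _        m =
  trans (cong₂ (λ a b → oneS 0 m ℤ.+ 0ℤ ℤ.- a ℤ.- b) (Z⊗-coeff-zero (B k) m) (Z⊗-coeff-zero X m)) (constant m)
  where
  constant : ∀ m → oneS 0 m ℤ.+ 0ℤ ℤ.- 0ℤ ℤ.- 0ℤ ≡ oneS 0 m
  constant zero    = refl
  constant (suc _) = refl

≈[]-levelDen : ∀ {X Y N} k → X ≈[ N ] Y → levelDen k X ≈[ suc N ] levelDen k Y
≈[]-levelDen k X≈Y = ≈[]-⊖ {oneS ⊕ zS ⊖ zS ⊗ B k} {oneS ⊕ zS ⊖ zS ⊗ B k} (λ _ _ _ → refl) (≈[]-Z⊗ X≈Y)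

cfTrunc-stable : ∀ {N N′} k → N ≤ N′ → cfTrunc N k ≈[ N ] cfTrunc N′ k
cfTrunc-stable {zero}            k _          _ ()
cfTrunc-stable {suc N} {suc N′} k (s≤s N≤N′) = ≈[]-invS (≈[]-levelDen k (cfTrunc-stable (suc k) N≤N′))

-- F_k of the paper: the z^n-coefficients of the truncations are constant from n + 1 levels on.
cf : ℕ → Ser
cf k n m = cfTrunc (suc n) k n m

cf-approx : ∀ N k → cf k ≈[ N ] cfTrunc N k
cf-approx N k n n<N m = cfTrunc-stable k n<N n ℕP.≤-refl m

cf-equation : ∀ k → cf k * levelDen k (cf (suc k)) ≈ 1#
cf-equation k = ≡⇒≈ λ n m → trans
  (≈[]-* {Y′ = den n} (cf-approx (suc (suc n)) k) (≈[]-levelDen k (cf-approx (suc n) (suc k)))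
          n (s≤s (ℕP.n≤1+n n)) m)
  (≈⇒≡ (invS-inverse (den n) (levelDen≈[]1 k (cfTrunc (suc n) (suc k)))) n m)
  where
  den : ℕ → Ser
  den n = levelDen k (cfTrunc (suc n) (suc k))

B-equation : ∀ k → B k * (1# - (S - 1#) * Z * qint k) ≈ 1#
B-equation k = 𝕊.trans (*-cong (𝕊.refl {B k}) (𝕊.sym denominator≈)) (invS-inverse _ denominator≈[]1)
  where
  z-multiple : (sS ⊖ oneS) ⊗ zS ⊗ qint k ≈ Z * ((sS ⊖ oneS) * qint k)
  z-multiple = 𝕊.trans (⊗≈* ((sS ⊖ oneS) ⊗ zS) (qint k))
    (𝕊.trans (*-cong (⊗≈* (sS ⊖ oneS) zS) (𝕊.refl {qint k}))
    (solve 3 (λ s′ z q → s′ :* z :* q := z :* (s′ :* q)) 𝕊.refl (sS ⊖ oneS) Z (qint k)))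
  denominator≈ : oneS ⊖ (sS ⊖ oneS) ⊗ zS ⊗ qint k ≈ 1# - (S - 1#) * Z * qint k
  denominator≈ = +-cong oneS≈1# (𝕊.-‿cong (𝕊.trans (⊗≈* ((sS ⊖ oneS) ⊗ zS) (qint k))
    (*-cong (𝕊.trans (⊗≈* (sS ⊖ oneS) zS) (*-cong (+-cong (𝕊.refl {S}) (𝕊.-‿cong oneS≈1#)) (𝕊.refl {Z})))
            (𝕊.refl {qint k}))))
  denominator≈[]1 : (oneS ⊖ (sS ⊖ oneS) ⊗ zS ⊗ qint k) ≈[ 1 ] oneS
  denominator≈[]1 (suc n) (s≤s ()) _
  denominator≈[]1 zero    _        m = trans (cong (λ a → oneS 0 m ℤ.- a) (trans (≈⇒≡ z-multiple 0 m)
    (Z*-coeff-zero ((sS ⊖ oneS) * qint k) m))) (constant m)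
    where
    constant : ∀ m → oneS 0 m ℤ.- 0ℤ ≡ oneS 0 m
    constant zero    = refl
    constant (suc _) = refl

levelDen≈ : ∀ k X → levelDen k X ≈ 1# + Z - Z * B k - Z * X
levelDen≈ k X =
  +-cong (+-cong (+-cong oneS≈1# (𝕊.refl {Z})) (𝕊.-‿cong (⊗≈* zS (B k)))) (𝕊.-‿cong (⊗≈* zS X))

P : ℕ → Ser
P k = B k + cf (suc k) - 1#

cf-unfold : ∀ k → cf k ≈ 1# + Z * (P k * cf k)
cf-unfold k = begin
  F                                                 ≈⟨ solve 4 (λ F b F′ z →
      F := F :* (con 1ℤ :+ z :- z :* b :- z :* F′) :+ z :* ((b :+ F′ :- con 1ℤ) :* F)) 𝕊.refl F (B k) F′ Z ⟩
  F * (1# + Z - Z * B k - Z * F′) + Z * (P k * F)   ≈⟨ +-cong (𝕊.trans (*-cong (𝕊.refl {F}) (𝕊.sym (levelDen≈ k F′)))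
                                                                          (cf-equation k)) (𝕊.refl {Z * (P k * F)}) ⟩
  1# + Z * (P k * F)                                ∎
  where
  open import Relation.Binary.Reasoning.Setoid 𝕊.setoid
  F = cf k
  F′ = cf (suc k)

B-unfold : ∀ k → B k ≈ 1# + (S - 1#) * Z * qint k * B k
B-unfold k = 𝕊.trans
  (solve 4 (λ b s z q → b := b :* (con 1ℤ :- (s :- con 1ℤ) :* z :* q) :+ (s :- con 1ℤ) :* z :* q :* b)
         𝕊.refl (B k) S Z (qint k))
  (+-cong (B-equation k) (𝕊.refl {(S - 1#) * Z * qint k * B k}))

qint-one : qint 1 ≈ 1#
qint-one = 𝕊.trans (+-cong zeroS≈0# oneS≈1#) (𝕊.+-identityˡ 1#)

qint-suc : ∀ h → qint (suc h) ≈ 1# + Z * qint h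
qint-suc zero    = 𝕊.trans qint-one (𝕊.sym (𝕊.trans (+-cong (𝕊.refl {1#}) Z*zeroS≈0#) (𝕊.+-identityʳ 1#)))
  where
  Z*zeroS≈0# : Z * zeroS ≈ 0#
  Z*zeroS≈0# = 𝕊.trans (*-cong (𝕊.refl {Z}) zeroS≈0#) (𝕊.zeroʳ Z)
qint-suc (suc h) = begin
  qint (suc h) + powS zS (suc h)                 ≈⟨ +-cong (qint-suc h) (powS≈^ zS (suc h)) ⟩
  (1# + Z * qint h) + Z * Z ^ h                  ≈⟨ +-cong (𝕊.refl {1# + Z * qint h})
                                                           (*-cong (𝕊.refl {Z}) (𝕊.sym (powS≈^ zS h))) ⟩
  (1# + Z * qint h) + Z * powS zS h              ≈⟨ solve 3 (λ z q w → (con 1ℤ :+ z :* q) :+ z :* w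
                                                                      := con 1ℤ :+ z :* (q :+ w))
                                                          𝕊.refl Z (qint h) (powS zS h) ⟩
  1# + Z * (qint h + powS zS h)                  ∎
  where open import Relation.Binary.Reasoning.Setoid 𝕊.setoid

prodF : ℕ → Ser
prodF zero    = cf 1
prodF (suc h) = cf (suc (suc h)) * prodF h

prodFP prodFB : ℕ → Ser
prodFP h = P (suc h) * prodF h
prodFB h = B (suc h) * prodF h

prodF-zero : prodF 0 ≈ 1# + Z * prodFP 0
prodF-zero = cf-unfold 1

prodF-suc : ∀ h → prodF (suc h) ≈ prodF h + Z * prodFP (suc h)
prodF-suc h = 𝕊.trans (*-cong (cf-unfold (suc (suc h))) (𝕊.refl {prodF h}))
  (solve 4 (λ F p x z → (con 1ℤ :+ z :* (p :* F)) :* x := x :+ z :* (p :* (F :* x)))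
         𝕊.refl (cf (suc (suc h))) (P (suc (suc h))) (prodF h) Z)

prodFP-unfold : ∀ h → prodFP h ≈ prodFB h + Z * prodFP (suc h)
prodFP-unfold h = 𝕊.trans
  (*-cong (+-cong (+-cong (𝕊.refl {B (suc h)}) (cf-unfold (suc (suc h)))) (𝕊.refl {𝕊.- 1#})) (𝕊.refl {prodF h}))
  (solve 5 (λ b F p x z → (b :+ (con 1ℤ :+ z :* (p :* F)) :- con 1ℤ) :* x := b :* x :+ z :* (p :* (F :* x)))
         𝕊.refl (B (suc h)) (cf (suc (suc h))) (P (suc (suc h))) (prodF h) Z)

-- Completions of a suffix that starts with u^(k+1) at height h; the second term accounts
-- for the prefixes ending in exactly d^(k+1), which close a symmetric valley.
atAscent : ℕ → ℕ → Ser
atAscent h k = prodF h + (S - 1#) * prodFB (h ℕ.+ k) * Z ^ suc k * qint (suc h)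

-- The correction for a suffix d^k u^j ⋯ : the block becomes a symmetric valley
-- exactly when the prefix supplies j − k further down steps.
descentCorrection : ℕ → ℕ → ℕ → Ser
descentCorrection h zero    j       = Z ^ j * prodFB (h ℕ.+ j)
descentCorrection h (suc k) zero    = 0#
descentCorrection h (suc k) (suc j) = descentCorrection h k j

atDescent : ℕ → ℕ → ℕ → Ser
atDescent h j k = prodFP h + (S - 1#) * descentCorrection h k j

atAscent-zero : ∀ h → atAscent h 0 ≈ prodFB h
atAscent-zero h rewrite ℕP.+-identityʳ h = 𝕊.trans
  (solve 5 (λ b s z q x → x :+ (s :- con 1ℤ) :* (b :* x) :* (z :* con 1ℤ) :* q
                          := (con 1ℤ :+ (s :- con 1ℤ) :* z :* q :* b) :* x)
         𝕊.refl (B (suc h)) S Z (qint (suc h)) (prodF h))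
  (*-cong (𝕊.sym (B-unfold (suc h))) (𝕊.refl {prodF h}))

prodFP-split : ∀ h → prodFP h ≈ atAscent h 0 + Z * prodFP (suc h)
prodFP-split h = 𝕊.trans (prodFP-unfold h) (+-cong (𝕊.sym (atAscent-zero h)) (𝕊.refl {Z * prodFP (suc h)}))

atAscent-start : ∀ k → atAscent 0 k ≈ 1# + Z * atDescent 0 (suc k) 1
atAscent-start k = 𝕊.trans
  (+-cong prodF-zero (*-cong (𝕊.refl {(S - 1#) * prodFB k * Z ^ suc k}) qint-one))
  (solve 5 (λ u s z w v → (con 1ℤ :+ z :* u) :+ (s :- con 1ℤ) :* v :* (z :* w) :* con 1ℤ
                          := con 1ℤ :+ z :* (u :+ (s :- con 1ℤ) :* (w :* v)))
         𝕊.refl (prodFP 0) S Z (Z ^ k) (prodFB k))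

atAscent-suc : ∀ h k → atAscent (suc h) k ≈ atAscent h (suc k) + Z * atDescent (suc h) (suc k) 1
atAscent-suc h k rewrite ℕP.+-suc h k = 𝕊.trans
  (+-cong (prodF-suc h) (*-cong (𝕊.refl {(S - 1#) * v * Z ^ suc k}) (qint-suc (suc h))))
  (solve 7 (λ x u s z w v q → (x :+ z :* u) :+ (s :- con 1ℤ) :* v :* (z :* w) :* (con 1ℤ :+ z :* q)
                              := (x :+ (s :- con 1ℤ) :* v :* (z :* (z :* w)) :* q) :+ z :* (u :+ (s :- con 1ℤ) :* (w :* v)))
         𝕊.refl (prodF h) (prodFP (suc h)) S Z (Z ^ k) v (qint (suc h)))
  where v = prodFB (suc (h ℕ.+ k))

descentCorrection-unfold : ∀ h k j →
  descentCorrection h k j ≈ (if k ℕ.≡ᵇ j then prodFB h else 0#) + Z * descentCorrection (suc h) (suc k) j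
descentCorrection-unfold h zero zero rewrite ℕP.+-identityʳ h =
  solve 2 (λ v z → con 1ℤ :* v := v :+ z :* con 0ℤ) 𝕊.refl (prodFB h) Z
descentCorrection-unfold h zero (suc j) rewrite ℕP.+-suc h j =
  solve 3 (λ z w v → z :* w :* v := con 0ℤ :+ z :* (w :* v)) 𝕊.refl Z (Z ^ j) (prodFB (suc (h ℕ.+ j)))
descentCorrection-unfold h (suc k) zero    = solve 1 (λ z → con 0ℤ := con 0ℤ :+ z :* con 0ℤ) 𝕊.refl Z
descentCorrection-unfold h (suc k) (suc j) = descentCorrection-unfold h k j

atDescent-unfold : ∀ h j k →
  atDescent h j k ≈ (if k ℕ.≡ᵇ j then S else 1#) * atAscent h 0 + Z * atDescent (suc h) j (suc k)
atDescent-unfold h j k = begin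
    prodFP h + (S - 1#) * c
  ≈⟨ +-cong (prodFP-unfold h) (*-cong (𝕊.refl {S - 1#}) (descentCorrection-unfold h k j)) ⟩
    (v + Z * u′) + (S - 1#) * (δ + Z * c′)
  ≈⟨ solve 6 (λ v u′ c′ δ s z → (v :+ z :* u′) :+ (s :- con 1ℤ) :* (δ :+ z :* c′)
                                := (v :+ (s :- con 1ℤ) :* δ) :+ z :* (u′ :+ (s :- con 1ℤ) :* c′))
             𝕊.refl v u′ c′ δ S Z ⟩
    (v + (S - 1#) * δ) + Z * (u′ + (S - 1#) * c′)
  ≈⟨ +-cong (valley (k ℕ.≡ᵇ j)) (𝕊.refl {Z * atDescent (suc h) j (suc k)}) ⟩
    (if k ℕ.≡ᵇ j then S else 1#) * atAscent h 0 + Z * atDescent (suc h) j (suc k) ∎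
  where
  open import Relation.Binary.Reasoning.Setoid 𝕊.setoid
  c = descentCorrection h k j
  c′ = descentCorrection (suc h) (suc k) j
  u′ = prodFP (suc h)
  v = prodFB h
  δ = if k ℕ.≡ᵇ j then v else 0#
  valley : ∀ b → v + (S - 1#) * (if b then v else 0#) ≈ (if b then S else 1#) * atAscent h 0
  valley true  = 𝕊.trans (solve 2 (λ v s → v :+ (s :- con 1ℤ) :* v := s :* v) 𝕊.refl v S)
                         (*-cong (𝕊.refl {S}) (𝕊.sym (atAscent-zero h)))
  valley false = 𝕊.trans (solve 2 (λ v s → v :+ (s :- con 1ℤ) :* con 0ℤ := con 1ℤ :* v) 𝕊.refl v S)
                         (*-cong (𝕊.refl {1#}) (𝕊.sym (atAscent-zero h)))

-- Counting Dyck paths by reading them from right to left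

prependStep : Step → Maybe ℕ → Maybe ℕ
prependStep U (just (suc h)) = just h
prependStep U _              = nothing
prependStep D (just h)       = just (suc h)
prependStep D nothing        = nothing

startHeight : List Step → Maybe ℕ
startHeight []      = just 0
startHeight (x ∷ w) = prependStep x (startHeight w)

startsAt : Maybe ℕ → ℕ → Bool
startsAt (just a) h = h ℕ.≡ᵇ a
startsAt nothing  _ = false

dyckFrom≡startsAt : ∀ w h → dyckFrom h w ≡ startsAt (startHeight w) h
dyckFrom≡startsAt []      h = refl
dyckFrom≡startsAt (U ∷ w) h with startHeight w | dyckFrom≡startsAt w (suc h)
... | just zero    | eq = eq
... | just (suc _) | eq = eq
... | nothing      | eq = eq
dyckFrom≡startsAt (D ∷ w) zero with startHeight w
... | just _  = refl
... | nothing = refl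
dyckFrom≡startsAt (D ∷ w) (suc h) with startHeight w | dyckFrom≡startsAt w h
... | just _  | eq = eq
... | nothing | eq = eq

State : Set
State = Maybe ℕ × List (Step × ℕ)

state : List Step → State
state w = startHeight w , runs w

step : Step → State → State
step x (h , r) = prependStep x h , push x r

accepts : ℕ → State → Bool
accepts m (h , r) = startsAt h 0 ∧ (svalRuns r ℕ.≡ᵇ m)

-- The number of words w of length L such that w followed by a suffix in state σ
-- is a Dyck path with m symmetric valleys.
completions : ℕ → State → ℕ → ℕ
completions m σ zero    = if accepts m σ then 1 else 0
completions m σ (suc L) = completions m (step U σ) L ℕ.+ completions m (step D σ) L

countTrue-cong : ∀ {A : Set} {p q : A → Bool} xs → (∀ x → p x ≡ q x) → countTrue p xs ≡ countTrue q xs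
countTrue-cong         []       p≡q = refl
countTrue-cong         (x ∷ xs) p≡q =
  cong₂ ℕ._+_ (cong (λ b → if b then 1 else 0) (p≡q x)) (countTrue-cong xs p≡q)

countTrue-++ : ∀ {A : Set} (p : A → Bool) xs ys → countTrue p (xs ++ ys) ≡ countTrue p xs ℕ.+ countTrue p ys
countTrue-++ p []       ys = refl
countTrue-++ p (x ∷ xs) ys =
  trans (cong ((if p x then 1 else 0) ℕ.+_) (countTrue-++ p xs ys)) (sym (ℕP.+-assoc (if p x then 1 else 0) _ _))

countTrue-map : ∀ {A B : Set} (p : B → Bool) (f : A → B) xs → countTrue p (map f xs) ≡ countTrue (p ∘ f) xs
countTrue-map p f []       = refl
countTrue-map p f (x ∷ xs) = cong ((if p (f x) then 1 else 0) ℕ.+_) (countTrue-map p f xs)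

countTrue-words : ∀ L (p : List Step → Bool) →
  countTrue p (words (suc L)) ≡ countTrue (p ∘ (U ∷_)) (words L) ℕ.+ countTrue (p ∘ (D ∷_)) (words L)
countTrue-words L p = trans (countTrue-++ p (map (U ∷_) (words L)) _)
  (cong₂ ℕ._+_ (countTrue-map p _ (words L)) (countTrue-map p _ (words L)))

countTrue-words-∷ʳ : ∀ L (p : List Step → Bool) →
  countTrue p (words (suc L)) ≡ countTrue (λ w → p (w ∷ʳ U)) (words L) ℕ.+ countTrue (λ w → p (w ∷ʳ D)) (words L)
countTrue-words-∷ʳ zero    p =
  sym (cong (ℕ._+ countTrue p ((D ∷ []) ∷ [])) (ℕP.+-identityʳ (if p (U ∷ []) then 1 else 0)))
countTrue-words-∷ʳ (suc L) p = begin
    countTrue p (words (suc (suc L)))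
  ≡⟨ countTrue-words (suc L) p ⟩
    countTrue (p ∘ (U ∷_)) (words (suc L)) ℕ.+ countTrue (p ∘ (D ∷_)) (words (suc L))
  ≡⟨ cong₂ ℕ._+_ (countTrue-words-∷ʳ L (p ∘ (U ∷_))) (countTrue-words-∷ʳ L (p ∘ (D ∷_))) ⟩
    (count U U ℕ.+ count U D) ℕ.+ (count D U ℕ.+ count D D)
  ≡⟨ interchange (count U U) _ _ _ ⟩
    (count U U ℕ.+ count D U) ℕ.+ (count U D ℕ.+ count D D)
  ≡⟨ cong₂ ℕ._+_ (countTrue-words L (λ w → p (w ∷ʳ U))) (countTrue-words L (λ w → p (w ∷ʳ D))) ⟨
    countTrue (λ w → p (w ∷ʳ U)) (words (suc L)) ℕ.+ countTrue (λ w → p (w ∷ʳ D)) (words (suc L)) ∎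
  where
  open ≡-Reasoning
  open CommutativeSemigroupProperties ℕP.+-commutativeSemigroup using (interchange)
  count : Step → Step → ℕ
  count x y = countTrue (λ w → p (x ∷ w ∷ʳ y)) (words L)

countTrue≡completions : ∀ m L σ → countTrue (λ w → accepts m (foldr step σ w)) (words L) ≡ completions m σ L
countTrue≡completions m zero    σ = ℕP.+-identityʳ _
countTrue≡completions m (suc L) σ = trans (countTrue-words-∷ʳ L _) (cong₂ ℕ._+_
  (trans (countTrue-cong (words L) (λ w → cong (accepts m) (foldr-∷ʳ step σ U w))) (countTrue≡completions m L (step U σ)))
  (trans (countTrue-cong (words L) (λ w → cong (accepts m) (foldr-∷ʳ step σ D w))) (countTrue≡completions m L (step D σ))))

foldr-step : ∀ w → foldr step (just 0 , []) w ≡ state w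
foldr-step []      = refl
foldr-step (x ∷ w) = cong (step x) (foldr-step w)

dyckCount≡completions : ∀ n m → dyckCount n m ≡ completions m (just 0 , []) (2 ℕ.* n)
dyckCount≡completions n m = trans (countTrue-cong (words (2 ℕ.* n)) accepted) (countTrue≡completions m (2 ℕ.* n) _)
  where
  accepted : ∀ w → (isDyck w ∧ (sval w ℕ.≡ᵇ m)) ≡ accepts m (foldr step (just 0 , []) w)
  accepted w = trans (cong (_∧ (sval w ℕ.≡ᵇ m)) (dyckFrom≡startsAt w 0)) (cong (accepts m) (sym (foldr-step w)))

completions-nothing : ∀ m L r → completions m (nothing , r) L ≡ 0
completions-nothing m zero    r = refl
completions-nothing m (suc L) r = cong₂ ℕ._+_ (completions-nothing m L (push U r)) (completions-nothing m L (push D r))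

completions-below : ∀ m L h r → L < h → completions m (just h , r) L ≡ 0
completions-below m zero    (suc h)       r _         = refl
completions-below m (suc L) (suc (suc h)) r (s≤s L<h) = cong₂ ℕ._+_
  (completions-below m L (suc h) (push U r) L<h)
  (completions-below m L (suc (suc (suc h))) (push D r) (ℕP.m<n⇒m<1+n (ℕP.m<n⇒m<1+n L<h)))

-- The generating series of the completions of a suffix

data RunShape : ℕ → List (Step × ℕ) → Set where
  ground  : RunShape 0 []
  ascent  : ∀ {h} k r → RunShape h ((U , suc k) ∷ r)
  descent : ∀ {h} k r → RunShape (suc h) ((D , suc k) ∷ r)

push-U-shape : ∀ h r → RunShape h (push U r)
push-U-shape h []            = ascent 0 []
push-U-shape h ((U , k) ∷ r) = ascent k r
push-U-shape h ((D , k) ∷ r) = ascent 0 ((D , k) ∷ r)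

push-D-shape : ∀ h r → RunShape (suc h) (push D r)
push-D-shape h []            = descent 0 []
push-D-shape h ((U , k) ∷ r) = descent 0 ((U , k) ∷ r)
push-D-shape h ((D , k) ∷ r) = descent k r

-- The coefficient of zᵈ sᵐ is the number of prefixes with d down steps that complete a
-- suffix with run list r entered at height h.  The last clause only covers run lists
-- that do not occur: runs of length 0, and a suffix starting with a down step at height 0.
completionSeries : ℕ → List (Step × ℕ) → Ser
completionSeries _       []                                = prodF 0
completionSeries h       ((U , suc k) ∷ r)                 = S ^ svalRuns r * atAscent h k
completionSeries (suc h) ((D , suc k) ∷ [])                = prodFP h
completionSeries (suc h) ((D , suc k) ∷ (U , j) ∷ r)       = S ^ svalRuns r * atDescent h j (suc k)
completionSeries (suc h) ((D , suc k) ∷ r@((D , _) ∷ _))   = S ^ svalRuns r * prodFP h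
completionSeries _       _                                 = 0#

S^-scale : ∀ c {X Y W} → X ≈ Y + Z * W → S ^ c * X ≈ S ^ c * Y + Z * (S ^ c * W)
S^-scale c {X} {Y} {W} X≈ = 𝕊.trans (*-cong (𝕊.refl {S ^ c}) X≈)
  (solve 4 (λ t y z w → t :* (y :+ z :* w) := t :* y :+ z :* (t :* w)) 𝕊.refl (S ^ c) Y Z W)

S^-indicator : ∀ b c A → S ^ c * ((if b then S else 1#) * A) ≈ S ^ ((if b then 1 else 0) ℕ.+ c) * A
S^-indicator true  c A = solve 3 (λ t s a → t :* (s :* a) := s :* t :* a) 𝕊.refl (S ^ c) S A
S^-indicator false c A = solve 2 (λ t a → t :* (con 1ℤ :* a) := t :* a) 𝕊.refl (S ^ c) A

completionSeries-ground : ∀ {r} → RunShape 0 r →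
  completionSeries 0 r ≈ S ^ svalRuns r + Z * completionSeries 1 (push D r)
completionSeries-ground ground         = prodF-zero
completionSeries-ground (ascent k r) =
  𝕊.trans (S^-scale (svalRuns r) {atAscent 0 k} {1#} {atDescent 0 (suc k) 1} (atAscent-start k))
  (+-cong (𝕊.*-identityʳ (S ^ svalRuns r)) (𝕊.refl {Z * completionSeries 1 (push D ((U , suc k) ∷ r))}))

completionSeries-step : ∀ {h r} → RunShape (suc h) r →
  completionSeries (suc h) r ≈ completionSeries h (push U r) + Z * completionSeries (suc (suc h)) (push D r)
completionSeries-step {h} (ascent k r)                 =
  S^-scale (svalRuns r) {atAscent (suc h) k} {atAscent h (suc k)} {atDescent (suc h) (suc k) 1} (atAscent-suc h k)
completionSeries-step {h} (descent k [])               =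
  𝕊.trans (prodFP-split h) (+-cong (𝕊.sym (𝕊.*-identityˡ (atAscent h 0))) (𝕊.refl {Z * prodFP (suc h)}))
completionSeries-step {h} (descent k ((U , j) ∷ r))    =
  𝕊.trans (S^-scale (svalRuns r) {atDescent h j (suc k)} {(if suc k ℕ.≡ᵇ j then S else 1#) * atAscent h 0}
                            {atDescent (suc h) j (suc (suc k))} (atDescent-unfold h j (suc k)))
          (+-cong (S^-indicator (suc k ℕ.≡ᵇ j) (svalRuns r) (atAscent h 0))
                  (𝕊.refl {Z * (S ^ svalRuns r * atDescent (suc h) j (suc (suc k)))}))
completionSeries-step {h} (descent k ((D , j) ∷ r))    =
  S^-scale (svalRuns ((D , j) ∷ r)) {prodFP h} {atAscent h 0} {prodFP (suc h)} (prodFP-split h)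

+-indicator : ∀ b → + (if b then 1 else 0) ≡ (if b then 1ℤ else 0ℤ) ℤ.+ 0ℤ
+-indicator true  = refl
+-indicator false = refl

twoDownSteps : ∀ h d → h ℕ.+ suc d ℕ.+ suc d ≡ suc (suc (h ℕ.+ d ℕ.+ d))
twoDownSteps h d = trans (cong (ℕ._+ suc d) (ℕP.+-suc h d)) (cong suc (ℕP.+-suc (h ℕ.+ d) d))

completions≡coeff : ∀ m d h {r} → RunShape h r →
  + completions m (just h , r) (h ℕ.+ d ℕ.+ d) ≡ completionSeries h r d m
completions≡coeff m zero zero {r} shape = begin
  + (if svalRuns r ℕ.≡ᵇ m then 1 else 0)              ≡⟨ +-indicator _ ⟩
  (if svalRuns r ℕ.≡ᵇ m then 1ℤ else 0ℤ) ℤ.+ 0ℤ      ≡⟨ cong₂ ℤ._+_ (S^-coeff-zero (svalRuns r) m) (Z*-coeff-zero down m) ⟨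
  (S ^ svalRuns r + Z * down) 0 m                    ≡⟨ ≈⇒≡ (completionSeries-ground shape) 0 m ⟨
  completionSeries 0 r 0 m                           ∎
  where
  open ≡-Reasoning
  down = completionSeries 1 (push D r)
completions≡coeff m (suc d) zero {r} shape = begin
  + (completions m (nothing , push U r) L ℕ.+ completions m (just 1 , push D r) L)
    ≡⟨ cong (λ t → + (t ℕ.+ completions m (just 1 , push D r) L)) (completions-nothing m L (push U r)) ⟩
  + completions m (just 1 , push D r) L
    ≡⟨ cong (+_ ∘ completions m (just 1 , push D r)) (ℕP.+-suc d d) ⟩
  + completions m (just 1 , push D r) (1 ℕ.+ d ℕ.+ d)
    ≡⟨ completions≡coeff m d 1 (push-D-shape 0 r) ⟩
  down d m
    ≡⟨ ℤP.+-identityˡ _ ⟨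
  0ℤ ℤ.+ down d m
    ≡⟨ cong₂ ℤ._+_ (S^-coeff-suc (svalRuns r) d m) (Z*-coeff-suc down d m) ⟨
  (S ^ svalRuns r + Z * down) (suc d) m
    ≡⟨ ≈⇒≡ (completionSeries-ground shape) (suc d) m ⟨
  completionSeries 0 r (suc d) m ∎
  where
  open ≡-Reasoning
  L = d ℕ.+ suc d
  down = completionSeries 1 (push D r)
completions≡coeff m zero (suc h) {r} shape = begin
  + (countUp ℕ.+ completions m (just (suc (suc h)) , push D r) L)
    ≡⟨ cong (λ t → + (countUp ℕ.+ t)) (completions-below m L _ (push D r) L<2+h) ⟩
  + (countUp ℕ.+ 0)
    ≡⟨ cong +_ (ℕP.+-identityʳ _) ⟩
  + countUp
    ≡⟨ completions≡coeff m 0 h (push-U-shape h r) ⟩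
  up 0 m
    ≡⟨ ℤP.+-identityʳ _ ⟨
  up 0 m ℤ.+ 0ℤ
    ≡⟨ cong (λ t → up 0 m ℤ.+ t) (Z*-coeff-zero down m) ⟨
  (up + Z * down) 0 m
    ≡⟨ ≈⇒≡ (completionSeries-step shape) 0 m ⟨
  completionSeries (suc h) r 0 m ∎
  where
  open ≡-Reasoning
  L = h ℕ.+ 0 ℕ.+ 0
  countUp = completions m (just h , push U r) L
  up = completionSeries h (push U r)
  down = completionSeries (suc (suc h)) (push D r)
  L<2+h : L < suc (suc h)
  L<2+h = ℕP.≤-<-trans (ℕP.≤-reflexive (trans (ℕP.+-identityʳ _) (ℕP.+-identityʳ h)))
                       (ℕP.m<n⇒m<1+n (ℕP.n<1+n h))
completions≡coeff m (suc d) (suc h) {r} shape = begin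
  + (countUp ℕ.+ countDown L)
    ≡⟨ ℤP.pos-+ countUp (countDown L) ⟩
  + countUp ℤ.+ + countDown L
    ≡⟨ cong (λ L′ → + countUp ℤ.+ + countDown L′) (twoDownSteps h d) ⟩
  + countUp ℤ.+ + countDown (suc (suc h) ℕ.+ d ℕ.+ d)
    ≡⟨ cong₂ ℤ._+_ (completions≡coeff m (suc d) h (push-U-shape h r))
                   (completions≡coeff m d (suc (suc h)) (push-D-shape (suc h) r)) ⟩
  up (suc d) m ℤ.+ down d m
    ≡⟨ cong (λ t → up (suc d) m ℤ.+ t) (Z*-coeff-suc down d m) ⟨
  (up + Z * down) (suc d) m
    ≡⟨ ≈⇒≡ (completionSeries-step shape) (suc d) m ⟨
  completionSeries (suc h) r (suc d) m ∎
  where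
  open ≡-Reasoning
  L = h ℕ.+ suc d ℕ.+ suc d
  countUp = completions m (just h , push U r) L
  countDown = completions m (just (suc (suc h)) , push D r)
  up = completionSeries h (push U r)
  down = completionSeries (suc (suc h)) (push D r)

cf-coeff : ∀ n m → cf 1 n m ≡ + dyckCount n m
cf-coeff n m = begin
  completionSeries 0 [] n m                          ≡⟨ completions≡coeff m n 0 ground ⟨
  + completions m (just 0 , []) (n ℕ.+ n)            ≡⟨ cong (+_ ∘ completions m (just 0 , []) ∘ (n ℕ.+_))
                                                              (ℕP.+-identityʳ n) ⟨
  + completions m (just 0 , []) (2 ℕ.* n)            ≡⟨ cong +_ (dyckCount≡completions n m) ⟨
  + dyckCount n m                                    ∎
  where open ≡-Reasoning

theorem3p1 : (n m : ℕ) → ∃[ N₀ ] ((N : ℕ) → N₀ ≤ N → cfTrunc N 1 n m ≡ + dyckCount n m)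
theorem3p1 n m = suc n , agree
  where
  agree : (N : ℕ) → suc n ≤ N → cfTrunc N 1 n m ≡ + dyckCount n m
  agree N n<N = trans (sym (cf-approx N 1 n n<N m)) (cf-coeff n m)
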